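{- For all integers $m>1$ and $n\ge1$, the dimension of $P(m,n)$ is $mn$.
   Context: A sign matrix is a matrix with entries in $\{ -1,0,1\}$ whose column partial sums from the top lie in $\{0,1\}$ and whose row partial sums from the left are nonnegative. $P(m,n)$ is the convex hull in $\mathbb{R}^{mn}$ of all $m\times n$ sign matrices.
   Formalization: The polytope P(m,n) lies in ℚ^(mn) instead of $\mathbb{R}^{mn}$, its convex combinations have rational weights, and its dimension is measured by affine independence over the rationals. -}

module Defs where

open import Data.Nat using (ℕ; zero; suc)
open import Data.Fin using (Fin; zero; suc)
open import Data.Integer as ℤ using (ℤ; 0ℤ; 1ℤ; -1ℤ)
open import Data.Rational as ℚ using (ℚ; 0ℚ; 1ℚ)
open import Data.List using (List; []; _∷_)
open import Data.Product using (Σ; _×_; _,_; ∃)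
open import Data.Sum using (_⊎_)
open import Data.Unit using (⊤)
open import Relation.Binary.PropositionalEquality using (_≡_)
open import Relation.Nullary using (¬_)

sumℤ : ∀ {n} → (Fin n → ℤ) → ℤ
sumℤ {zero}  f = 0ℤ
sumℤ {suc n} f = f zero ℤ.+ sumℤ (λ i → f (suc i))

sumℚ : ∀ {n} → (Fin n → ℚ) → ℚ
sumℚ {zero}  f = 0ℚ
sumℚ {suc n} f = f zero ℚ.+ sumℚ (λ i → f (suc i))

-- prefixSum f k = f 0 + ... + f (k-1)  (truncated at n)
prefixSum : ∀ {n} → (Fin n → ℤ) → ℕ → ℤ
prefixSum {zero}  f k       = 0ℤ
prefixSum {suc n} f zero    = 0ℤ
prefixSum {suc n} f (suc k) = f zero ℤ.+ prefixSum (λ i → f (suc i)) k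

Matrix : ℕ → ℕ → Set
Matrix m n = Fin m → Fin n → ℤ

record IsSignMatrix {m n : ℕ} (M : Matrix m n) : Set where
  field
    entries  : ∀ i j → M i j ≡ -1ℤ ⊎ (M i j ≡ 0ℤ ⊎ M i j ≡ 1ℤ)
    colSums  : ∀ j (k : ℕ) → prefixSum (λ i → M i j) k ≡ 0ℤ ⊎ prefixSum (λ i → M i j) k ≡ 1ℤ
    rowSums  : ∀ i (k : ℕ) → 0ℤ ℤ.≤ prefixSum (λ j → M i j) k

SignMatrix : ℕ → ℕ → Set
SignMatrix m n = Σ (Matrix m n) IsSignMatrix

-- points of the ambient space ℚ^{mn}, viewed as m × n arrays
Point : ℕ → ℕ → Set
Point m n = Fin m → Fin n → ℚ

toPoint : ∀ {m n} → Matrix m n → Point m n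
toPoint M i j = M i j ℚ./ 1

-- finite formal convex combinations of sign matrices
weightSum : ∀ {m n} → List (ℚ × SignMatrix m n) → ℚ
weightSum []            = 0ℚ
weightSum ((w , _) ∷ c) = w ℚ.+ weightSum c

nonneg : ∀ {m n} → List (ℚ × SignMatrix m n) → Set
nonneg []            = ⊤
nonneg ((w , _) ∷ c) = (0ℚ ℚ.≤ w) × nonneg c

evalComb : ∀ {m n} → List (ℚ × SignMatrix m n) → Point m n
evalComb []                  i j = 0ℚ
evalComb ((w , (M , _)) ∷ c) i j = w ℚ.* toPoint M i j ℚ.+ evalComb c i j

-- membership in P(m,n) = convex hull of all m × n sign matrices
InP : (m n : ℕ) → Point m n → Set
InP m n x = ∃ λ (c : List (ℚ × SignMatrix m n)) →
  nonneg c × (weightSum c ≡ 1ℚ) × (evalComb c ≡ x)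

AffinelyIndependent : ∀ {m n k} → (Fin (suc k) → Point m n) → Set
AffinelyIndependent {m} {n} {k} p =
  (λ' : Fin (suc k) → ℚ) →
  sumℚ λ' ≡ 0ℚ →
  (∀ i j → sumℚ (λ t → λ' t ℚ.* p t i j) ≡ 0ℚ) →
  ∀ t → λ' t ≡ 0ℚ

HasDimension : ∀ {m n} → (Point m n → Set) → ℕ → Set
HasDimension {m} {n} S d =
  (∃ λ (p : Fin (suc d) → Point m n) → (∀ t → S (p t)) × AffinelyIndependent p)
  × ((p : Fin (suc (suc d)) → Point m n) → (∀ t → S (p t)) → ¬ AffinelyIndependent p)

-- Upper bound: ℚ^{mn} contains no mn+2 affinely independent points.  An
-- affine dependence among points p₀ … p_k is a nonzero solution of a
-- homogeneous linear system with one equation per coordinate plus the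
-- equation Σ λₜ = 0, i.e. mn+1 equations in k+1 unknowns.  We prove the
-- general fact that a homogeneous system over ℚ with fewer equations than
-- unknowns has a nonzero solution (Gaussian elimination: pick a row with a
-- nonzero leading coefficient, eliminate the first unknown from the other
-- rows, solve the smaller system, back-substitute).
--
-- Lower bound: the zero matrix and the mn matrix units E_{ij} are sign
-- matrices, and as points of ℚ^{mn} they are affinely independent: the
-- (i,j) coordinate of a combination Σ λₜ pₜ is the coefficient of E_{ij}.
--
-- Neither bound needs the hypotheses m > 1 and n ≥ 1.

module Submission where

open import Defs
open import Data.Nat as ℕ using (ℕ; _*_; _<_; _≤_; zero; suc; s<s⁻¹)
open import Data.Nat.Properties using (n<1+n)
open import Data.Fin using (Fin; zero; suc; remQuot; combine; punchIn)
open import Data.Fin.Properties using (_≟_; remQuot-combine; combine-remQuot; punchInᵢ≢i)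
open import Data.Integer as ℤ using (ℤ; 0ℤ; 1ℤ)
import Data.Integer.Properties as ℤP
open import Data.Rational as ℚ using (ℚ; 0ℚ; 1ℚ; _+_; _-_; -_)
  renaming (_*_ to _·_)
import Data.Rational.Properties as ℚP
open import Data.Rational.Solver using (module +-*-Solver)
open import Algebra.Bundles using (CommutativeRing)
import Algebra.Properties.Semiring.Sum as SemiringSum
open import Data.Vec.Functional using (Vector; head; tail)
open import Data.List using (List; []; _∷_; length; map; tabulate)
open import Data.List.Properties using (length-map; length-tabulate)
open import Data.List.Relation.Unary.All as All using (All; []; _∷_)
open import Data.List.Relation.Unary.All.Properties using (map⁻; tabulate⁻)
open import Data.List.Relation.Binary.Permutation.Propositional
  using (_↭_; ↭-refl; ↭-prep; ↭-swap; ↭-sym; ↭-trans)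
open import Data.List.Relation.Binary.Permutation.Propositional.Properties
  using (All-resp-↭; ↭-length)
open import Data.Product using (_×_; _,_; proj₁; proj₂; uncurry)
open import Data.Sum using (_⊎_; inj₁; inj₂)
open import Data.Unit using (tt)
open import Data.Empty using (⊥-elim)
open import Function using (_∘_)
open import Relation.Nullary using (¬_; yes; no)
open import Relation.Binary.PropositionalEquality

open +-*-Solver using (solve; _:+_; _:*_; _:-_; :-_; _:=_; con)

module Σℚ = SemiringSum (CommutativeRing.semiring ℚP.+-*-commutativeRing)

sumℚ≡sum : ∀ {v} (f : Vector ℚ v) → sumℚ f ≡ Σℚ.sum f
sumℚ≡sum {zero}  f = refl
sumℚ≡sum {suc v} f = cong (head f +_) (sumℚ≡sum (tail f))

sumℚ-cong : ∀ {v} {f g : Vector ℚ v} → (∀ t → f t ≡ g t) → sumℚ f ≡ sumℚ g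
sumℚ-cong {f = f} {g} f≗g =
  trans (sumℚ≡sum f) (trans (Σℚ.sum-cong-≗ f≗g) (sym (sumℚ≡sum g)))

sumℚ-zero : ∀ {v} (f : Vector ℚ v) → (∀ t → f t ≡ 0ℚ) → sumℚ f ≡ 0ℚ
sumℚ-zero {v} f f≗0 =
  trans (sumℚ-cong f≗0) (trans (sumℚ≡sum {v} (λ _ → 0ℚ)) (Σℚ.sum-replicate-zero v))

sumℚ-+ : ∀ {v} (f g : Vector ℚ v) → sumℚ (λ t → f t + g t) ≡ sumℚ f + sumℚ g
sumℚ-+ f g = begin
  sumℚ (λ t → f t + g t)    ≡⟨ sumℚ≡sum (λ t → f t + g t) ⟩
  Σℚ.sum (λ t → f t + g t)  ≡⟨ Σℚ.∑-distrib-+ f g ⟩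
  Σℚ.sum f + Σℚ.sum g       ≡⟨ sym (cong₂ _+_ (sumℚ≡sum f) (sumℚ≡sum g)) ⟩
  sumℚ f + sumℚ g           ∎
  where open ≡-Reasoning

sumℚ-scale : ∀ {v} (a : ℚ) (f : Vector ℚ v) → sumℚ (λ t → a · f t) ≡ a · sumℚ f
sumℚ-scale a f = begin
  sumℚ (λ t → a · f t)    ≡⟨ sumℚ≡sum (λ t → a · f t) ⟩
  Σℚ.sum (λ t → a · f t)  ≡⟨ sym (Σℚ.*-distribˡ-sum a f) ⟩
  a · Σℚ.sum f            ≡⟨ sym (cong (a ·_) (sumℚ≡sum f)) ⟩
  a · sumℚ f              ∎
  where open ≡-Reasoning

sumℚ-single : ∀ {v} (f : Vector ℚ (suc v)) (c : Fin (suc v)) →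
              (∀ t → t ≢ c → f t ≡ 0ℚ) → sumℚ f ≡ f c
sumℚ-single {v} f c off = begin
  sumℚ f                        ≡⟨ sumℚ≡sum f ⟩
  Σℚ.sum f                      ≡⟨ Σℚ.sum-remove f ⟩
  f c + Σℚ.sum (f ∘ punchIn c)  ≡⟨ cong (f c +_) rest≡0 ⟩
  f c + 0ℚ                      ≡⟨ ℚP.+-identityʳ (f c) ⟩
  f c                           ∎
  where
    open ≡-Reasoning
    rest≡0 : Σℚ.sum (f ∘ punchIn c) ≡ 0ℚ
    rest≡0 = trans (sym (sumℚ≡sum (f ∘ punchIn c))) (sumℚ-zero _ (λ s → off _ (punchInᵢ≢i c s)))

-- Homogeneous linear systems over ℚ.  An equation is a row of coefficients;
-- `dot r x` is the value of the left-hand side at the vector of unknowns x.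

Row : ℕ → Set
Row v = Vector ℚ v

dot : ∀ {v} → Row v → Vector ℚ v → ℚ
dot r x = sumℚ (λ t → x t · r t)

record NontrivialSolution {v} (L : List (Row v)) : Set where
  field
    solution  : Vector ℚ v
    satisfies : All (λ r → dot r solution ≡ 0ℚ) L
    witness   : Fin v
    nonzero   : solution witness ≢ 0ℚ

data PivotSplit {v} (L : List (Row (suc v))) : Set where
  no-pivot : All (λ r → head r ≡ 0ℚ) L → PivotSplit L
  pivot    : (r₀ : Row (suc v)) (rest : List (Row (suc v))) →
             head r₀ ≢ 0ℚ → L ↭ r₀ ∷ rest → PivotSplit L

pivotSplit : ∀ {v} (L : List (Row (suc v))) → PivotSplit L
pivotSplit [] = no-pivot []
pivotSplit (r ∷ L) with head r ℚ.≟ 0ℚ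
... | no r≢0  = pivot r L r≢0 ↭-refl
... | yes r≡0 with pivotSplit L
...   | no-pivot L≡0          = no-pivot (r≡0 ∷ L≡0)
...   | pivot r₀ rest r₀≢0 L↭ = pivot r₀ (r ∷ rest) r₀≢0 (↭-trans (↭-prep r L↭) (↭-swap r r₀ ↭-refl))

eliminate : ∀ {v} → Row (suc v) → Row (suc v) → Row v
eliminate r₀ r t = head r₀ · r (suc t) - head r · r₀ (suc t)

dot-eliminate : ∀ {v} (r₀ r : Row (suc v)) (y : Vector ℚ v) →
  dot (eliminate r₀ r) y ≡ head r₀ · dot (tail r) y + (- head r) · dot (tail r₀) y
dot-eliminate r₀ r y = begin
  dot (eliminate r₀ r) y
    ≡⟨ sumℚ-cong (λ t → distribute (y t) a (r (suc t)) c (r₀ (suc t))) ⟩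
  sumℚ (λ t → a · (y t · r (suc t)) + (- c) · (y t · r₀ (suc t)))
    ≡⟨ sumℚ-+ (λ t → a · (y t · r (suc t))) (λ t → (- c) · (y t · r₀ (suc t))) ⟩
  sumℚ (λ t → a · (y t · r (suc t))) + sumℚ (λ t → (- c) · (y t · r₀ (suc t)))
    ≡⟨ cong₂ _+_ (sumℚ-scale a (λ t → y t · r (suc t))) (sumℚ-scale (- c) (λ t → y t · r₀ (suc t))) ⟩
  a · dot (tail r) y + (- c) · dot (tail r₀) y ∎
  where
    open ≡-Reasoning
    a = head r₀
    c = head r
    distribute : ∀ y a r c s → y · (a · r - c · s) ≡ a · (y · r) + (- c) · (y · s)
    distribute = solve 5 (λ y a r c s → y :* (a :* r :- c :* s) := a :* (y :* r) :+ (:- c) :* (y :* s)) refl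

-- Given a solution y of the eliminated system, the value of the first
-- unknown is forced by the pivot equation (after scaling by head r₀).
backSubstitute : ∀ {v} → Row (suc v) → Vector ℚ v → Vector ℚ (suc v)
backSubstitute r₀ y zero    = - dot (tail r₀) y
backSubstitute r₀ y (suc t) = head r₀ · y t

dot-backSubstitute : ∀ {v} (r₀ r : Row (suc v)) (y : Vector ℚ v) →
  dot r (backSubstitute r₀ y) ≡ (- dot (tail r₀) y) · head r + head r₀ · dot (tail r) y
dot-backSubstitute r₀ r y = cong ((- dot (tail r₀) y) · head r +_)
  (trans (sumℚ-cong (λ t → ℚP.*-assoc (head r₀) (y t) (r (suc t))))
         (sumℚ-scale (head r₀) (λ t → y t · r (suc t))))

backSubstitute-correct : ∀ {v} (r₀ r : Row (suc v)) (y : Vector ℚ v) →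
  dot r (backSubstitute r₀ y) ≡ dot (eliminate r₀ r) y
backSubstitute-correct r₀ r y = begin
  dot r (backSubstitute r₀ y)         ≡⟨ dot-backSubstitute r₀ r y ⟩
  (- S) · head r + head r₀ · D        ≡⟨ exchange S (head r) (head r₀) D ⟩
  head r₀ · D + (- head r) · S        ≡⟨ sym (dot-eliminate r₀ r y) ⟩
  dot (eliminate r₀ r) y              ∎
  where
    open ≡-Reasoning
    S = dot (tail r₀) y
    D = dot (tail r) y
    exchange : ∀ S c a D → (- S) · c + a · D ≡ a · D + (- c) · S
    exchange = solve 4 (λ S c a D → (:- S) :* c :+ a :* D := a :* D :+ (:- c) :* S) refl

eliminate-self : ∀ {v} (r₀ : Row (suc v)) (y : Vector ℚ v) → dot (eliminate r₀ r₀) y ≡ 0ℚ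
eliminate-self r₀ y = trans (dot-eliminate r₀ r₀ y) (cancel (head r₀) (dot (tail r₀) y))
  where
    cancel : ∀ a S → a · S + (- a) · S ≡ 0ℚ
    cancel = solve 2 (λ a S → a :* S :+ (:- a) :* S := con 0ℚ) refl

·-cancel-nonzero : ∀ {a y} → a ≢ 0ℚ → a · y ≡ 0ℚ → y ≡ 0ℚ
·-cancel-nonzero {a} {y} a≢0 ay≡0 = begin
  y                    ≡⟨ sym (ℚP.*-identityˡ y) ⟩
  1ℚ · y               ≡⟨ cong (_· y) (sym (ℚP.*-inverseˡ a)) ⟩
  (ℚ.1/ a) · a · y     ≡⟨ ℚP.*-assoc (ℚ.1/ a) a y ⟩
  (ℚ.1/ a) · (a · y)   ≡⟨ cong ((ℚ.1/ a) ·_) ay≡0 ⟩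
  (ℚ.1/ a) · 0ℚ        ≡⟨ ℚP.*-zeroʳ (ℚ.1/ a) ⟩
  0ℚ                   ∎
  where
    open ≡-Reasoning
    instance a≠0 : ℚ.NonZero a
    a≠0 = ℚ.≢-nonZero a≢0

firstUnknownFree : ∀ {v} {L : List (Row (suc v))} →
  All (λ r → head r ≡ 0ℚ) L → NontrivialSolution L
firstUnknownFree {v} L≡0 = record
  { solution = e₀ ; satisfies = All.map (λ {r} → vanishes r) L≡0 ; witness = zero ; nonzero = ℚP.1≢0 }
  where
    e₀ : Vector ℚ (suc v)
    e₀ zero    = 1ℚ
    e₀ (suc _) = 0ℚ
    vanishes : ∀ r → head r ≡ 0ℚ → dot r e₀ ≡ 0ℚ
    vanishes r r₀≡0 = sumℚ-zero (λ t → e₀ t · r t) term≡0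
      where
        term≡0 : ∀ t → e₀ t · r t ≡ 0ℚ
        term≡0 zero    = trans (cong (1ℚ ·_) r₀≡0) (ℚP.*-zeroʳ 1ℚ)
        term≡0 (suc t) = ℚP.*-zeroˡ (r (suc t))

eliminationStep : ∀ {v} {L : List (Row (suc v))} (r₀ : Row (suc v)) (rest : List (Row (suc v))) →
  head r₀ ≢ 0ℚ → L ↭ r₀ ∷ rest →
  NontrivialSolution (map (eliminate r₀) rest) → NontrivialSolution L
eliminationStep r₀ rest r₀≢0 L↭ sol = record
  { solution  = backSubstitute r₀ y
  ; satisfies = All-resp-↭ (↭-sym L↭) (pivotSolved ∷ All.map (λ {r} → restSolved r) (map⁻ satisfies))
  ; witness   = suc witness
  ; nonzero   = nonzero ∘ ·-cancel-nonzero r₀≢0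
  }
  where
    open NontrivialSolution sol renaming (solution to y)
    pivotSolved : dot r₀ (backSubstitute r₀ y) ≡ 0ℚ
    pivotSolved = trans (backSubstitute-correct r₀ r₀ y) (eliminate-self r₀ y)
    restSolved : ∀ r → dot (eliminate r₀ r) y ≡ 0ℚ → dot r (backSubstitute r₀ y) ≡ 0ℚ
    restSolved r = trans (backSubstitute-correct r₀ r y)

homogeneous-nontrivial : ∀ {v} (L : List (Row v)) → length L < v → NontrivialSolution L
homogeneous-nontrivial {suc v} L |L|<v with pivotSplit L
... | no-pivot L≡0            = firstUnknownFree L≡0
... | pivot r₀ rest r₀≢0 L↭ =
  eliminationStep r₀ rest r₀≢0 L↭ (homogeneous-nontrivial (map (eliminate r₀) rest) fewer)
  where
    fewer : length (map (eliminate r₀) rest) < v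
    fewer = subst (_< v) (sym (length-map (eliminate r₀) rest))
                  (s<s⁻¹ (subst (_< suc v) (↭-length L↭) |L|<v))

-- Upper bound: k+1 points of ℚ^{mn} with k > mn are affinely dependent, since
-- an affine dependence solves mn+1 homogeneous equations in k+1 unknowns.
affinelyDependent : ∀ {m n k} → m * n < k → (p : Fin (suc k) → Point m n) →
                    ¬ AffinelyIndependent p
affinelyDependent {m} {n} {k} mn<k p independent =
  nonzero (independent solution weightsVanish coordinatesVanish witness)
  where
    coordinateRow : Fin (m * n) → Row (suc k)
    coordinateRow c t = uncurry (p t) (remQuot n c)
    equations : List (Row (suc k))
    equations = (λ _ → 1ℚ) ∷ tabulate coordinateRow
    fewer : length equations < suc k
    fewer = subst (λ l → suc l < suc k) (sym (length-tabulate coordinateRow)) (ℕ.s<s mn<k)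
    open NontrivialSolution (homogeneous-nontrivial equations fewer)
    weightsVanish : sumℚ solution ≡ 0ℚ
    weightsVanish = trans (sumℚ-cong (λ t → sym (ℚP.*-identityʳ (solution t)))) (All.head satisfies)
    coordinatesVanish : ∀ i j → sumℚ (λ t → solution t · p t i j) ≡ 0ℚ
    coordinatesVanish i j =
      subst (λ ij → sumℚ (λ t → solution t · uncurry (p t) ij) ≡ 0ℚ) (remQuot-combine i j)
            (tabulate⁻ (All.tail satisfies) (combine i j))

Bit : ℤ → Set
Bit z = z ≡ 0ℤ ⊎ z ≡ 1ℤ

bit-* : ∀ {x y} → Bit x → Bit y → Bit (x ℤ.* y)
bit-* (inj₁ refl) _           = inj₁ refl
bit-* (inj₂ refl) (inj₁ refl) = inj₁ refl
bit-* (inj₂ refl) (inj₂ refl) = inj₂ refl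

bit-nonneg : ∀ {x} → Bit x → 0ℤ ℤ.≤ x
bit-nonneg (inj₁ refl) = ℤP.≤-refl
bit-nonneg (inj₂ refl) = ℤ.+≤+ ℕ.z≤n

δ : ∀ {k} → Fin k → Fin k → ℤ
δ zero    zero    = 1ℤ
δ zero    (suc _) = 0ℤ
δ (suc _) zero    = 0ℤ
δ (suc a) (suc i) = δ a i

δ-bit : ∀ {k} (a i : Fin k) → Bit (δ a i)
δ-bit zero    zero    = inj₂ refl
δ-bit zero    (suc _) = inj₁ refl
δ-bit (suc _) zero    = inj₁ refl
δ-bit (suc a) (suc i) = δ-bit a i

δ-diag : ∀ {k} (a : Fin k) → δ a a ≡ 1ℤ
δ-diag zero    = refl
δ-diag (suc a) = δ-diag a

δ-off : ∀ {k} (a i : Fin k) → a ≢ i → δ a i ≡ 0ℤ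
δ-off zero    zero    a≢i = ⊥-elim (a≢i refl)
δ-off zero    (suc _) _   = refl
δ-off (suc _) zero    _   = refl
δ-off (suc a) (suc i) a≢i = δ-off a i (a≢i ∘ cong suc)

prefixSum-cong : ∀ {n} {f g : Fin n → ℤ} → (∀ i → f i ≡ g i) → ∀ k → prefixSum f k ≡ prefixSum g k
prefixSum-cong {zero}  f≗g k       = refl
prefixSum-cong {suc n} f≗g zero    = refl
prefixSum-cong {suc n} f≗g (suc k) = cong₂ ℤ._+_ (f≗g zero) (prefixSum-cong (f≗g ∘ suc) k)

prefixSum-zero : ∀ {n} {f : Fin n → ℤ} → (∀ i → f i ≡ 0ℤ) → ∀ k → prefixSum f k ≡ 0ℤ
prefixSum-zero {zero}  f≗0 k       = refl
prefixSum-zero {suc n} f≗0 zero    = refl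
prefixSum-zero {suc n} f≗0 (suc k) = cong₂ ℤ._+_ (f≗0 zero) (prefixSum-zero (f≗0 ∘ suc) k)

prefixSum-nonneg : ∀ {n} {f : Fin n → ℤ} → (∀ i → 0ℤ ℤ.≤ f i) → ∀ k → 0ℤ ℤ.≤ prefixSum f k
prefixSum-nonneg {zero}  f≥0 k       = ℤP.≤-refl
prefixSum-nonneg {suc n} f≥0 zero    = ℤP.≤-refl
prefixSum-nonneg {suc n} f≥0 (suc k) = ℤP.+-mono-≤ (f≥0 zero) (prefixSum-nonneg (f≥0 ∘ suc) k)

-- A delta sequence has a single 1, so its partial sums are bits.
prefixSum-δ : ∀ {n} (a : Fin n) k → Bit (prefixSum (δ a) k)
prefixSum-δ zero    zero    = inj₁ refl
prefixSum-δ {suc n} zero (suc k) = inj₂ (cong (ℤ._+_ 1ℤ) (prefixSum-zero {n} (λ _ → refl) k))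
prefixSum-δ (suc a) zero    = inj₁ refl
prefixSum-δ (suc a) (suc k) = subst Bit (sym (ℤP.+-identityˡ _)) (prefixSum-δ a k)

zeroMatrix : ∀ {m n} → Matrix m n
zeroMatrix i j = 0ℤ

zeroMatrix-isSign : ∀ {m n} → IsSignMatrix (zeroMatrix {m} {n})
zeroMatrix-isSign {m} {n} = record
  { entries = λ i j → inj₂ (inj₁ refl)
  ; colSums = λ j k → inj₁ (prefixSum-zero {m} (λ _ → refl) k)
  ; rowSums = λ i k → prefixSum-nonneg {n} (λ _ → ℤP.≤-refl) k
  }

unitMatrix : ∀ {m n} → Fin m × Fin n → Matrix m n
unitMatrix (i₀ , j₀) i j = δ i₀ i ℤ.* δ j₀ j

unitMatrix-bit : ∀ {m n} (q : Fin m × Fin n) i j → Bit (unitMatrix q i j)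
unitMatrix-bit (i₀ , j₀) i j = bit-* (δ-bit i₀ i) (δ-bit j₀ j)

-- Each column of E_{i₀j₀} is either zero or a delta sequence.
unitMatrix-isSign : ∀ {m n} (q : Fin m × Fin n) → IsSignMatrix (unitMatrix q)
unitMatrix-isSign q@(i₀ , j₀) = record
  { entries = λ i j → inj₂ (unitMatrix-bit q i j)
  ; colSums = colSums
  ; rowSums = λ i k → prefixSum-nonneg (λ j → bit-nonneg (unitMatrix-bit q i j)) k
  }
  where
    colSums : ∀ j k → Bit (prefixSum (λ i → unitMatrix q i j) k)
    colSums j k with δ-bit j₀ j
    ... | inj₁ δ≡0 = inj₁ (prefixSum-zero (λ i → trans (cong (δ i₀ i ℤ.*_) δ≡0) (ℤP.*-zeroʳ (δ i₀ i))) k)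
    ... | inj₂ δ≡1 = subst Bit (sym (prefixSum-cong (λ i → trans (cong (δ i₀ i ℤ.*_) δ≡1)
                                                              (ℤP.*-identityʳ (δ i₀ i))) k))
                               (prefixSum-δ i₀ k)

unitMatrix-diag : ∀ {m n} (i : Fin m) (j : Fin n) → unitMatrix (i , j) i j ≡ 1ℤ
unitMatrix-diag i j = cong₂ ℤ._*_ (δ-diag i) (δ-diag j)

unitMatrix-off : ∀ {m n} (q : Fin m × Fin n) i j → q ≢ (i , j) → unitMatrix q i j ≡ 0ℤ
unitMatrix-off (i₀ , j₀) i j q≢ij with i₀ ≟ i
... | no i₀≢i  = trans (cong (ℤ._* δ j₀ j) (δ-off i₀ i i₀≢i)) (ℤP.*-zeroˡ (δ j₀ j))
... | yes refl = trans (cong (δ i₀ i ℤ.*_) (δ-off j₀ j (q≢ij ∘ cong (i₀ ,_)))) (ℤP.*-zeroʳ (δ i₀ i))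

vertex : ∀ {m n} → SignMatrix m n → Point m n
vertex M = evalComb ((1ℚ , M) ∷ [])

vertex-in-P : ∀ {m n} (M : SignMatrix m n) → InP m n (vertex M)
vertex-in-P M = (1ℚ , M) ∷ [] , (ℚP.nonNegative⁻¹ 1ℚ , tt) , refl , refl

vertex-0 : ∀ {m n} (M : SignMatrix m n) i j → proj₁ M i j ≡ 0ℤ → vertex M i j ≡ 0ℚ
vertex-0 M i j Mij≡0 rewrite Mij≡0 = refl

vertex-1 : ∀ {m n} (M : SignMatrix m n) i j → proj₁ M i j ≡ 1ℤ → vertex M i j ≡ 1ℚ
vertex-1 M i j Mij≡1 rewrite Mij≡1 = refl

remQuot-injective : ∀ {m} n {s c : Fin (m * n)} → remQuot {m} n s ≡ remQuot n c → s ≡ c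
remQuot-injective {m} n {s} {c} eq = begin
  s                                   ≡⟨ sym (combine-remQuot {m} n s) ⟩
  uncurry combine (remQuot {m} n s)   ≡⟨ cong (uncurry combine) eq ⟩
  uncurry combine (remQuot {m} n c)   ≡⟨ combine-remQuot {m} n c ⟩
  c                                   ∎
  where open ≡-Reasoning

-- Lower bound: the zero matrix together with the mn matrix units, the unit
-- E_{ij} being indexed by the position c with remQuot n c = (i, j).
module UnitFamily (m n : ℕ) where

  position : Fin (m * n) → Fin m × Fin n
  position = remQuot n

  unitFamily : Fin (suc (m * n)) → SignMatrix m n
  unitFamily zero    = zeroMatrix , zeroMatrix-isSign
  unitFamily (suc c) = unitMatrix (position c) , unitMatrix-isSign (position c)

  coordinate : (λ' : Fin (suc (m * n)) → ℚ) (c : Fin (m * n)) →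
    sumℚ (λ t → λ' t · uncurry (vertex (unitFamily t)) (position c)) ≡ λ' (suc c)
  coordinate λ' c = begin
    sumℚ (λ t → λ' t · vertex (unitFamily t) i j)  ≡⟨ sumℚ-single _ (suc c) off ⟩
    λ' (suc c) · vertex (unitFamily (suc c)) i j   ≡⟨ cong (λ' (suc c) ·_) (vertex-1 (unitFamily (suc c)) i j (unitMatrix-diag i j)) ⟩
    λ' (suc c) · 1ℚ                                ≡⟨ ℚP.*-identityʳ (λ' (suc c)) ⟩
    λ' (suc c)                                     ∎
    where
      open ≡-Reasoning
      i = proj₁ (position c)
      j = proj₂ (position c)
      vanishes : ∀ t → t ≢ suc c → vertex (unitFamily t) i j ≡ 0ℚ
      vanishes zero    _   = refl
      vanishes (suc s) s≢c = vertex-0 (unitFamily (suc s)) i j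
        (unitMatrix-off (position s) i j (s≢c ∘ cong suc ∘ remQuot-injective {m} n))
      off : ∀ t → t ≢ suc c → λ' t · vertex (unitFamily t) i j ≡ 0ℚ
      off t t≢c = trans (cong (λ' t ·_) (vanishes t t≢c)) (ℚP.*-zeroʳ (λ' t))

  independent : AffinelyIndependent (vertex ∘ unitFamily)
  independent λ' weights≡0 coordinates≡0 = vanishes
    where
      unitCoefficient : ∀ c → λ' (suc c) ≡ 0ℚ
      unitCoefficient c =
        trans (sym (coordinate λ' c)) (coordinates≡0 (proj₁ (position c)) (proj₂ (position c)))
      vanishes : ∀ t → λ' t ≡ 0ℚ
      vanishes (suc c) = unitCoefficient c
      vanishes zero    = begin
        λ' zero                    ≡⟨ sym (ℚP.+-identityʳ (λ' zero)) ⟩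
        λ' zero + 0ℚ               ≡⟨ cong (λ' zero +_) (sym (sumℚ-zero (λ' ∘ suc) unitCoefficient)) ⟩
        λ' zero + sumℚ (λ' ∘ suc)  ≡⟨ weights≡0 ⟩
        0ℚ                         ∎
        where open ≡-Reasoning

proposition4p2 : (m n : ℕ) → 1 < m → 1 ≤ n → HasDimension (InP m n) (m * n)
proposition4p2 m n _ _ =
  (vertex ∘ unitFamily , (λ t → vertex-in-P (unitFamily t)) , independent)
  , (λ p _ → affinelyDependent (n<1+n (m * n)) p)
  where open UnitFamily m n
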